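{- Let $\mathbf V\subseteq\mathbf{M^{+}S4}$. Then $d(\mathbf V)\le n$ iff $d^0(\mathbf V)\le n$; equivalently, $\mathbf V\models P_n$ iff $\mathbf V\models P^0_n$.
   Context: $\mathsf{MS4}$-algebras are $(B,\lozenge,\exists)$ with $\lozenge$ an $\mathsf{S4}$ operator, $\exists$ an $\mathsf{S5}$ operator and $\exists\lozenge a\le\lozenge\exists a$; $\square=\neg\lozenge\neg$, $\forall=\neg\exists\neg$. $\mathbf{M^{+}S4}=\mathbf{MS4}+\mathsf{M^{+}Cas}$, $\mathsf{M^{+}Cas}=\square\forall(\square(\square p\to\square\forall p)\to\square\forall p)\to\square\forall p$. $P_1=\lozenge\square q_1\to\square q_1$, $P_n=\lozenge(\square q_n\wedge\neg P_{n-1})\to\square q_n$; $P^0_n$ is $P_n$ with $\lozenge$ replaced by $\lozenge\exists$ (and $\square$ by $\square\forall$). $d(\mathbf V)$ is the supremum of depths ($\lozenge$-depths) of algebras in $\mathbf V$; $d^0(\mathbf V)$ the supremum of depths of the $\mathsf{S4}$-algebras $\mathfrak A^0$ of $\exists$-fixpoints with restricted $\lozenge$ (i.e. the $\lozenge\exists$-depth). $\mathbf V\models P_n$ iff $d(\mathbf V)\le n$, and $\mathbf V\models P^0_n$ iff $d^0(\mathbf V)\le n$. -}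

module Defs where

open import Level using (0ℓ)
open import Data.Nat using (ℕ; zero; suc)
open import Relation.Binary.Core using (Rel)
open import Algebra.Lattice.Bundles using (BooleanAlgebra)

record MS4Algebra : Set₁ where
  field
    boolean : BooleanAlgebra 0ℓ 0ℓ
  open BooleanAlgebra boolean public

  _≤_ : Rel Carrier 0ℓ
  a ≤ b = (a ∧ b) ≈ a

  field
    ◇   : Carrier → Carrier
    ∃   : Carrier → Carrier
    ◇-cong : ∀ {a b} → a ≈ b → ◇ a ≈ ◇ b
    ∃-cong : ∀ {a b} → a ≈ b → ∃ a ≈ ∃ b
    ◇-⊥    : ◇ ⊥ ≈ ⊥
    ◇-∨    : ∀ a b → ◇ (a ∨ b) ≈ (◇ a ∨ ◇ b)
    ◇-T    : ∀ a → a ≤ ◇ a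
    ◇-4    : ∀ a → ◇ (◇ a) ≤ ◇ a
    ∃-⊥    : ∃ ⊥ ≈ ⊥
    ∃-∨    : ∀ a b → ∃ (a ∨ b) ≈ (∃ a ∨ ∃ b)
    ∃-T    : ∀ a → a ≤ ∃ a
    ∃-4    : ∀ a → ∃ (∃ a) ≤ ∃ a
    ∃-5    : ∀ a → ∃ (¬ ∃ a) ≤ (¬ ∃ a)
    ∃◇≤◇∃  : ∀ a → ∃ (◇ a) ≤ ◇ (∃ a)

data Fm : Set where
  var  : ℕ → Fm
  ⊥f   : Fm
  ⊤f   : Fm
  ¬f_  : Fm → Fm
  _∧f_ : Fm → Fm → Fm
  _∨f_ : Fm → Fm → Fm
  _⇒_  : Fm → Fm → Fm
  ◇f   : Fm → Fm
  ∃f   : Fm → Fm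

infixr 5 _⇒_
infixr 6 _∨f_
infixr 7 _∧f_
infix  8 ¬f_

□f : Fm → Fm
□f φ = ¬f ◇f (¬f φ)

∀f : Fm → Fm
∀f φ = ¬f ∃f (¬f φ)

module _ (A : MS4Algebra) where
  open MS4Algebra A

  ⟦_⟧ : Fm → (ℕ → Carrier) → Carrier
  ⟦ var i ⟧ v = v i
  ⟦ ⊥f ⟧ v = ⊥
  ⟦ ⊤f ⟧ v = ⊤
  ⟦ ¬f φ ⟧ v = ¬ ⟦ φ ⟧ v
  ⟦ φ ∧f ψ ⟧ v = ⟦ φ ⟧ v ∧ ⟦ ψ ⟧ v
  ⟦ φ ∨f ψ ⟧ v = ⟦ φ ⟧ v ∨ ⟦ ψ ⟧ v
  ⟦ φ ⇒ ψ ⟧ v = (¬ ⟦ φ ⟧ v) ∨ ⟦ ψ ⟧ v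
  ⟦ ◇f φ ⟧ v = ◇ (⟦ φ ⟧ v)
  ⟦ ∃f φ ⟧ v = ∃ (⟦ φ ⟧ v)

_⊨_ : MS4Algebra → Fm → Set
A ⊨ φ = ∀ (v : ℕ → MS4Algebra.Carrier A) → MS4Algebra._≈_ A (⟦ A ⟧ φ v) (MS4Algebra.⊤ A)

M⁺Cas : Fm
M⁺Cas = □f (∀f (□f (□f p ⇒ □f (∀f p)) ⇒ □f (∀f p))) ⇒ □f (∀f p)
  where p = var 0

-- By Birkhoff's theorem (and since every
-- equation s = t is equivalent to the formula s ↔ t) a subvariety of
-- M⁺S4 is exactly the class of MS4-algebras validating M⁺Cas together
-- with some set Γ of formulas.  We represent 𝐕 by such a Γ.

Variety : Set₁
Variety = Fm → Set

InV : Variety → MS4Algebra → Set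
InV Γ A = (A ⊨ M⁺Cas) × (∀ ψ → Γ ψ → A ⊨ ψ)
  where open import Data.Product using (_×_)

_⊨V_ : Variety → Fm → Set₁
Γ ⊨V φ = ∀ (A : MS4Algebra) → InV Γ A → A ⊨ φ

-- Depth formulas.  P n is the paper's P_n (for n ≥ 1; q_n = var n):
--   P_1 = ◇□q₁ → □q₁,  P_n = ◇(□q_n ∧ ¬P_{n-1}) → □q_n.
-- P 0 is an unused filler.

P : ℕ → Fm
P zero = ⊥f
P (suc zero) = ◇f (□f (var 1)) ⇒ □f (var 1)
P (suc (suc n)) = ◇f (□f q ∧f ¬f P (suc n)) ⇒ □f q
  where q = var (suc (suc n))

◇∃ : Fm → Fm
◇∃ φ = ◇f (∃f φ)

□∀ : Fm → Fm
□∀ φ = □f (∀f φ)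

P⁰ : ℕ → Fm
P⁰ zero = ⊥f
P⁰ (suc zero) = ◇∃ (□∀ (var 1)) ⇒ □∀ (var 1)
P⁰ (suc (suc n)) = ◇∃ (□∀ q ∧f ¬f P⁰ (suc n)) ⇒ □∀ q
  where q = var (suc (suc n))

-- Substituting ∀q for q turns P_n into P⁰_n: □∀q and everything built from ∃-fixpoints by
-- Boolean operations and ◇ is again an ∃-fixpoint, and on fixpoints ◇∃ agrees with ◇.
-- Conversely, M⁺Cas at an open p says that wherever □∀p fails, ◇∃ reaches a point where
-- □∀p fails although □(□p → □∀p) holds; for p = P_n such a point refutes P_n, so it sees
-- □q_n ∧ ¬P_{n-1} and, there, □∀P_n. Feeding this back through the nesting of P_n with
-- q_i := P_i gives ¬P_n ≤ ◇∃¬P⁰_n, so P⁰_n = ⊤ forces P_n = ⊤.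
module Submission where

open import Defs
open import Data.Nat using (ℕ; zero; suc)
open import Data.Product using (_×_; _,_; proj₁)
open import Function using (_∘_)
open import Relation.Binary.Core using (Rel)
open import Relation.Binary.Lattice.Structures using (IsLattice)
open import Relation.Binary.Lattice.Bundles using (Lattice)
open import Algebra.Core using (Op₁; Op₂)
open import Algebra.Lattice.Bundles using (BooleanAlgebra)

module BooleanOrder {c ℓ} (B : BooleanAlgebra c ℓ) where
  open BooleanAlgebra B
  open import Algebra.Lattice.Properties.BooleanAlgebra B
    using (∨-∧-isOrderTheoreticLattice; ∧-identityˡ; ∧-identityʳ; ∧-zeroˡ; ∨-identityˡ; ∨-identityʳ;
           ¬⊥≈⊤; ¬-involutive; deMorgan₂)

  infix 4 _≤_
  _≤_ : Rel Carrier ℓ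
  x ≤ y = x ∧ y ≈ x

  -- The library's lattice order is x ≈ x ∧ y; MS4Algebra uses the symmetric form.
  ≤-isLattice : IsLattice _≈_ _≤_ _∨_ _∧_
  ≤-isLattice = record
    { isPartialOrder = record
      { isPreorder = record
        { isEquivalence = isEquivalence
        ; reflexive     = λ x≈y → sym (L.reflexive x≈y)
        ; trans         = λ x≤y y≤z → sym (L.trans (sym x≤y) (sym y≤z))
        }
      ; antisym = λ x≤y y≤x → L.antisym (sym x≤y) (sym y≤x)
      }
    ; supremum = λ x y → let ub₁ , ub₂ , least = L.supremum x y in
        sym ub₁ , sym ub₂ , λ z x≤z y≤z → sym (least z (sym x≤z) (sym y≤z))
    ; infimum = λ x y → let lb₁ , lb₂ , greatest = L.infimum x y in
        sym lb₁ , sym lb₂ , λ z z≤x z≤y → sym (greatest z (sym z≤x) (sym z≤y))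
    }
    where module L = IsLattice ∨-∧-isOrderTheoreticLattice

  ≤-lattice : Lattice c ℓ ℓ
  ≤-lattice = record { isLattice = ≤-isLattice }

  open Lattice ≤-lattice public
    using (poset; x≤x∨y; y≤x∨y; ∨-least; x∧y≤x; x∧y≤y; ∧-greatest)
    renaming (refl to ≤-refl; reflexive to ≤-reflexive; trans to ≤-trans; antisym to ≤-antisym)
  open import Relation.Binary.Lattice.Properties.JoinSemilattice (Lattice.joinSemilattice ≤-lattice) public
    using (∨-monotonic; x≤y⇒x∨y≈y)
  open import Relation.Binary.Lattice.Properties.MeetSemilattice (Lattice.meetSemilattice ≤-lattice) public
    using (∧-monotonic)
  open import Relation.Binary.Reasoning.PartialOrder poset

  private variable x y z : Carrier

  ⊥≤x : ⊥ ≤ x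
  ⊥≤x {x} = ∧-zeroˡ x

  infixr 5 _⇨_
  _⇨_ : Op₂ Carrier
  x ⇨ y = ¬ x ∨ y

  ⇨-congʳ : x ≈ y → x ⇨ z ≈ y ⇨ z
  ⇨-congʳ x≈y = ∨-congʳ (¬-cong x≈y)

  y≤x⇨y : y ≤ x ⇨ y
  y≤x⇨y {y} {x} = y≤x∨y (¬ x) y

  ⇨-eval : (x ⇨ y) ∧ x ≤ y
  ⇨-eval {x} {y} = begin
    (¬ x ∨ y) ∧ x          ≈⟨ ∧-distribʳ-∨ x (¬ x) y ⟩
    (¬ x ∧ x) ∨ (y ∧ x)    ≈⟨ ∨-congʳ (∧-complementˡ x) ⟩
    ⊥ ∨ (y ∧ x)            ≈⟨ ∨-identityˡ (y ∧ x) ⟩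
    y ∧ x                  ≤⟨ x∧y≤x y x ⟩
    y                      ∎

  shunt : x ∧ y ≤ z → x ≤ y ⇨ z
  shunt {x} {y} {z} x∧y≤z = begin
    x                          ≈⟨ sym (∧-identityʳ x) ⟩
    x ∧ ⊤                      ≈⟨ ∧-congˡ (sym (∨-complementʳ y)) ⟩
    x ∧ (y ∨ ¬ y)              ≈⟨ ∧-distribˡ-∨ x y (¬ y) ⟩
    (x ∧ y) ∨ (x ∧ ¬ y)        ≤⟨ ∨-monotonic x∧y≤z (x∧y≤y x (¬ y)) ⟩
    z ∨ ¬ y                    ≈⟨ ∨-comm z (¬ y) ⟩
    y ⇨ z                      ∎

  ⇨≈⊤⇒≤ : x ⇨ y ≈ ⊤ → x ≤ y
  ⇨≈⊤⇒≤ {x} {y} x⇨y≈⊤ = begin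
    x              ≈⟨ sym (∧-identityˡ x) ⟩
    ⊤ ∧ x          ≈⟨ ∧-congʳ (sym x⇨y≈⊤) ⟩
    (x ⇨ y) ∧ x    ≤⟨ ⇨-eval ⟩
    y              ∎

  x∧y≤⊥⇒x≤¬y : x ∧ y ≤ ⊥ → x ≤ ¬ y
  x∧y≤⊥⇒x≤¬y {x} {y} x∧y≤⊥ = begin
    x        ≤⟨ shunt x∧y≤⊥ ⟩
    ¬ y ∨ ⊥  ≈⟨ ∨-identityʳ (¬ y) ⟩
    ¬ y      ∎

  ¬-antitone : x ≤ y → ¬ y ≤ ¬ x
  ¬-antitone {x} {y} x≤y = x∧y≤⊥⇒x≤¬y (begin
    ¬ y ∧ x  ≤⟨ ∧-monotonic ≤-refl x≤y ⟩
    ¬ y ∧ y  ≈⟨ ∧-complementˡ y ⟩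
    ⊥        ∎)

  ∧-contrapose : x ∧ y ≤ z → x ∧ ¬ z ≤ ¬ y
  ∧-contrapose {x} {y} {z} x∧y≤z = x∧y≤⊥⇒x≤¬y (begin
    (x ∧ ¬ z) ∧ y  ≤⟨ ∧-greatest (≤-trans (∧-monotonic (x∧y≤x x (¬ z)) ≤-refl) x∧y≤z)
                                 (≤-trans (x∧y≤x (x ∧ ¬ z) y) (x∧y≤y x (¬ z))) ⟩
    z ∧ ¬ z        ≈⟨ ∧-complementʳ z ⟩
    ⊥              ∎)

  ¬x∧[x∨y]≤y : ¬ x ∧ (x ∨ y) ≤ y
  ¬x∧[x∨y]≤y {x} {y} = begin
    ¬ x ∧ (x ∨ y)          ≈⟨ ∧-distribˡ-∨ (¬ x) x y ⟩
    (¬ x ∧ x) ∨ (¬ x ∧ y)  ≈⟨ ∨-congʳ (∧-complementˡ x) ⟩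
    ⊥ ∨ (¬ x ∧ y)          ≈⟨ ∨-identityˡ (¬ x ∧ y) ⟩
    ¬ x ∧ y                ≤⟨ x∧y≤y (¬ x) y ⟩
    y                      ∎

  ¬⇨≈ : ¬ (x ⇨ y) ≈ x ∧ ¬ y
  ¬⇨≈ {x} {y} = trans (deMorgan₂ (¬ x) y) (∧-congʳ (¬-involutive x))

  x∧¬⊥≈x : x ∧ ¬ ⊥ ≈ x
  x∧¬⊥≈x {x} = trans (∧-congˡ ¬⊥≈⊤) (∧-identityʳ x)

  ¬≤⊥⇒≈⊤ : ¬ x ≤ ⊥ → x ≈ ⊤
  ¬≤⊥⇒≈⊤ {x} ¬x≤⊥ = begin-equality
    x        ≈⟨ sym (¬-involutive x) ⟩
    ¬ ¬ x    ≈⟨ ¬-cong (≤-antisym ¬x≤⊥ ⊥≤x) ⟩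
    ¬ ⊥      ≈⟨ ¬⊥≈⊤ ⟩
    ⊤        ∎

  module NormalOperator (f : Op₁ Carrier) (f-cong : ∀ {x y} → x ≈ y → f x ≈ f y)
                        (f-∨ : ∀ x y → f (x ∨ y) ≈ f x ∨ f y) where

    f-mono : x ≤ y → f x ≤ f y
    f-mono {x} {y} x≤y = begin
      f x        ≤⟨ x≤x∨y (f x) (f y) ⟩
      f x ∨ f y  ≈⟨ f-∨ x y ⟨
      f (x ∨ y)  ≈⟨ f-cong (x≤y⇒x∨y≈y x≤y) ⟩
      f y        ∎

    ¬f¬∧f≤f∧ : ¬ f (¬ x) ∧ f y ≤ f (x ∧ y)
    ¬f¬∧f≤f∧ {x} {y} = begin
      ¬ f (¬ x) ∧ f y                    ≤⟨ ∧-monotonic ≤-refl (f-mono (shunt (≤-reflexive (∧-comm y x)))) ⟩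
      ¬ f (¬ x) ∧ f (¬ x ∨ x ∧ y)        ≈⟨ ∧-congˡ (f-∨ (¬ x) (x ∧ y)) ⟩
      ¬ f (¬ x) ∧ (f (¬ x) ∨ f (x ∧ y))  ≤⟨ ¬x∧[x∨y]≤y ⟩
      f (x ∧ y)                          ∎

module MS4Properties (A : MS4Algebra) where
  open MS4Algebra A hiding (_≤_)
  open BooleanOrder boolean
  open import Algebra.Lattice.Properties.BooleanAlgebra boolean using (¬-involutive; ¬⊤≈⊥)
  open import Relation.Binary.Reasoning.PartialOrder poset

  private variable x y : Carrier

  □ : Op₁ Carrier
  □ x = ¬ ◇ (¬ x)

  ∀′ : Op₁ Carrier
  ∀′ x = ¬ ∃ (¬ x)

  -- The paper's ◇∃ and □∀: the modalities of the S4-algebra of ∃-fixpoints.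
  ◇₀ : Op₁ Carrier
  ◇₀ x = ◇ (∃ x)

  □₀ : Op₁ Carrier
  □₀ x = □ (∀′ x)

  open NormalOperator ◇ ◇-cong ◇-∨
    renaming (f-mono to ◇-mono; ¬f¬∧f≤f∧ to □∧◇≤◇∧)
  open NormalOperator ∃ ∃-cong ∃-∨
    renaming (f-mono to ∃-mono)
    hiding (¬f¬∧f≤f∧)

  ◇₀-cong : x ≈ y → ◇₀ x ≈ ◇₀ y
  ◇₀-cong x≈y = ◇-cong (∃-cong x≈y)

  ◇₀-∨ : ∀ x y → ◇₀ (x ∨ y) ≈ ◇₀ x ∨ ◇₀ y
  ◇₀-∨ x y = trans (◇-cong (∃-∨ x y)) (◇-∨ (∃ x) (∃ y))

  open NormalOperator ◇₀ ◇₀-cong ◇₀-∨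
    renaming (f-mono to ◇₀-mono; ¬f¬∧f≤f∧ to ¬◇₀¬∧◇₀≤◇₀∧)

  ◇₀-⊥ : ◇₀ ⊥ ≈ ⊥
  ◇₀-⊥ = trans (◇-cong ∃-⊥) ◇-⊥

  ◇₀-T : x ≤ ◇₀ x
  ◇₀-T {x} = ≤-trans (∃-T x) (◇-T (∃ x))

  ◇◇₀≤◇₀ : ◇ (◇₀ x) ≤ ◇₀ x
  ◇◇₀≤◇₀ {x} = ◇-4 (∃ x)

  ◇₀-4 : ◇₀ (◇₀ x) ≤ ◇₀ x
  ◇₀-4 {x} = begin
    ◇ (∃ (◇ (∃ x)))  ≤⟨ ◇-mono (∃◇≤◇∃ (∃ x)) ⟩
    ◇ (◇ (∃ (∃ x)))  ≤⟨ ◇-4 (∃ (∃ x)) ⟩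
    ◇ (∃ (∃ x))      ≤⟨ ◇-mono (∃-4 x) ⟩
    ◇ (∃ x)          ∎

  □-mono : x ≤ y → □ x ≤ □ y
  □-mono x≤y = ¬-antitone (◇-mono (¬-antitone x≤y))

  □x≤x : □ x ≤ x
  □x≤x {x} = ≤-trans (¬-antitone (◇-T (¬ x))) (≤-reflexive (¬-involutive x))

  ∀′x≤x : ∀′ x ≤ x
  ∀′x≤x {x} = ≤-trans (¬-antitone (∃-T (¬ x))) (≤-reflexive (¬-involutive x))

  □₀x≤x : □₀ x ≤ x
  □₀x≤x = ≤-trans □x≤x ∀′x≤x

  ¬□₀≈◇₀¬ : ¬ □₀ x ≈ ◇₀ (¬ x)
  ¬□₀≈◇₀¬ {x} = trans (¬-involutive _) (◇-cong (¬-involutive _))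

  □₀≤¬◇₀¬□₀ : □₀ x ≤ ¬ ◇₀ (¬ □₀ x)
  □₀≤¬◇₀¬□₀ {x} = begin
    □₀ x                ≈⟨ ¬-involutive (□₀ x) ⟨
    ¬ ¬ □₀ x            ≈⟨ ¬-cong ¬□₀≈◇₀¬ ⟩
    ¬ ◇₀ (¬ x)          ≤⟨ ¬-antitone (≤-trans (◇₀-mono (≤-reflexive ¬□₀≈◇₀¬)) ◇₀-4) ⟩
    ¬ ◇₀ (¬ □₀ x)       ∎

  Open : Carrier → Set
  Open x = x ≤ □ x

  open-¬◇ : Open (¬ ◇ x)
  open-¬◇ {x} = ¬-antitone (begin
    ◇ (¬ ¬ ◇ x)  ≈⟨ ◇-cong (¬-involutive (◇ x)) ⟩
    ◇ (◇ x)      ≤⟨ ◇-4 x ⟩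
    ◇ x          ∎)

  open-resp-≈ : x ≈ y → Open x → Open y
  open-resp-≈ {x} {y} x≈y x-open = begin
    y    ≈⟨ x≈y ⟨
    x    ≤⟨ x-open ⟩
    □ x  ≈⟨ ¬-cong (◇-cong (¬-cong x≈y)) ⟩
    □ y  ∎

  open-∨ : Open x → Open y → Open (x ∨ y)
  open-∨ {x} {y} x-open y-open =
    ∨-least (≤-trans x-open (□-mono (x≤x∨y x y))) (≤-trans y-open (□-mono (y≤x∨y x y)))

  Fixed : Carrier → Set
  Fixed x = ∃ x ≈ x

  ∃x≤x⇒fixed : ∃ x ≤ x → Fixed x
  ∃x≤x⇒fixed {x} ∃x≤x = ≤-antisym ∃x≤x (∃-T x)

  fixed-⊥ : Fixed ⊥
  fixed-⊥ = ∃-⊥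

  fixed-∃ : Fixed (∃ x)
  fixed-∃ {x} = ∃x≤x⇒fixed (∃-4 x)

  fixed-¬ : Fixed x → Fixed (¬ x)
  fixed-¬ {x} x-fixed = ∃x≤x⇒fixed (begin
    ∃ (¬ x)      ≈⟨ ∃-cong (¬-cong x-fixed) ⟨
    ∃ (¬ ∃ x)    ≤⟨ ∃-5 x ⟩
    ¬ ∃ x        ≈⟨ ¬-cong x-fixed ⟩
    ¬ x          ∎)

  fixed-∧ : Fixed x → Fixed y → Fixed (x ∧ y)
  fixed-∧ {x} {y} x-fixed y-fixed = ∃x≤x⇒fixed (begin
    ∃ (x ∧ y)    ≤⟨ ∧-greatest (∃-mono (x∧y≤x x y)) (∃-mono (x∧y≤y x y)) ⟩
    ∃ x ∧ ∃ y    ≈⟨ ∧-cong x-fixed y-fixed ⟩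
    x ∧ y        ∎)

  fixed-∨ : Fixed x → Fixed y → Fixed (x ∨ y)
  fixed-∨ {x} {y} x-fixed y-fixed = trans (∃-∨ x y) (∨-cong x-fixed y-fixed)

  fixed-◇ : Fixed x → Fixed (◇ x)
  fixed-◇ {x} x-fixed = ∃x≤x⇒fixed (≤-trans (∃◇≤◇∃ x) (◇-mono (≤-reflexive x-fixed)))

  fixed-◇₀ : Fixed (◇₀ x)
  fixed-◇₀ = fixed-◇ fixed-∃

  fixed-□₀ : Fixed (□₀ x)
  fixed-□₀ = fixed-¬ (fixed-◇ (fixed-¬ (fixed-¬ fixed-∃)))

  ◇₀-fixed : Fixed x → ◇₀ x ≈ ◇ x
  ◇₀-fixed = ◇-cong

  casari : A ⊨ M⁺Cas → ∀ p → □₀ (□ (□ p ⇨ □₀ p) ⇨ □₀ p) ≤ □₀ p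
  casari cas p = ⇨≈⊤⇒≤ (cas (λ _ → p))

  -- M⁺Cas at p yields ◇₀(□w ∧ ¬□₀p); such a point lies outside p, hence sees c ∧ b, and
  -- there w together with c ≤ □p gives □₀p.
  casari-step : ∀ {p c b} → A ⊨ M⁺Cas → Open p → c ≤ p → ¬ p ≤ ◇ (c ∧ b) →
                ¬ □₀ p ≤ ◇₀ (◇ (b ∧ □₀ p) ∧ ¬ □₀ p)
  casari-step {p} {c} {b} cas p-open c≤p ¬p≤◇[c∧b] = begin
    ¬ u                   ≤⟨ ¬-antitone (casari cas p) ⟩
    ¬ □₀ (□ w ⇨ u)        ≈⟨ ¬□₀≈◇₀¬ ⟩
    ◇₀ (¬ (□ w ⇨ u))      ≈⟨ ◇₀-cong ¬⇨≈ ⟩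
    ◇₀ (□ w ∧ ¬ u)        ≤⟨ ◇₀-mono (∧-greatest □w∧¬u≤◇[b∧u] (x∧y≤y (□ w) (¬ u))) ⟩
    ◇₀ (◇ (b ∧ u) ∧ ¬ u)  ∎
    where
    u = □₀ p
    w = □ p ⇨ u

    w∧□p≤u : w ∧ □ p ≤ u
    w∧□p≤u = ⇨-eval

    □w∧p≤u : □ w ∧ p ≤ u
    □w∧p≤u = ≤-trans (∧-monotonic □x≤x p-open) w∧□p≤u

    w∧[c∧b]≤b∧u : w ∧ (c ∧ b) ≤ b ∧ u
    w∧[c∧b]≤b∧u = ∧-greatest (≤-trans (x∧y≤y w (c ∧ b)) (x∧y≤y c b))
      (≤-trans (∧-monotonic ≤-refl (≤-trans (x∧y≤x c b) (≤-trans c≤p p-open))) w∧□p≤u)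

    □w∧¬u≤◇[b∧u] : □ w ∧ ¬ u ≤ ◇ (b ∧ u)
    □w∧¬u≤◇[b∧u] = begin
      □ w ∧ ¬ u        ≤⟨ ∧-greatest (x∧y≤x (□ w) (¬ u)) (∧-contrapose □w∧p≤u) ⟩
      □ w ∧ ¬ p        ≤⟨ ∧-monotonic ≤-refl ¬p≤◇[c∧b] ⟩
      □ w ∧ ◇ (c ∧ b)  ≤⟨ □∧◇≤◇∧ ⟩
      ◇ (w ∧ (c ∧ b))  ≤⟨ ◇-mono w∧[c∧b]≤b∧u ⟩
      ◇ (b ∧ u)        ∎

  P-unfold : ∀ n v → ⟦ A ⟧ (P (suc n)) v ≈ ◇ (□ (v (suc n)) ∧ ¬ ⟦ A ⟧ (P n) v) ⇨ □ (v (suc n))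
  P-unfold zero    v = ⇨-congʳ (◇-cong (sym x∧¬⊥≈x))
  P-unfold (suc n) v = refl

  P⁰-unfold : ∀ n v → ⟦ A ⟧ (P⁰ (suc n)) v ≈ ◇₀ (□₀ (v (suc n)) ∧ ¬ ⟦ A ⟧ (P⁰ n) v) ⇨ □₀ (v (suc n))
  P⁰-unfold zero    v = ⇨-congʳ (◇₀-cong (sym x∧¬⊥≈x))
  P⁰-unfold (suc n) v = refl

  P⁰-fixed : ∀ n v → Fixed (⟦ A ⟧ (P⁰ n) v)
  P⁰-fixed zero          v = fixed-⊥
  P⁰-fixed (suc zero)    v = fixed-∨ (fixed-¬ fixed-◇₀) fixed-□₀
  P⁰-fixed (suc (suc n)) v = fixed-∨ (fixed-¬ fixed-◇₀) fixed-□₀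

  P⁰≈P∘∀′ : ∀ n v → ⟦ A ⟧ (P⁰ n) v ≈ ⟦ A ⟧ (P n) (∀′ ∘ v)
  P⁰≈P∘∀′ zero    v = refl
  P⁰≈P∘∀′ (suc n) v = begin-equality
    ⟦ A ⟧ (P⁰ (suc n)) v                          ≈⟨ P⁰-unfold n v ⟩
    ◇₀ (□₀ q ∧ ¬ ⟦ A ⟧ (P⁰ n) v) ⇨ □₀ q           ≈⟨ ⇨-congʳ (◇₀-fixed (fixed-∧ fixed-□₀ (fixed-¬ (P⁰-fixed n v)))) ⟩
    ◇ (□₀ q ∧ ¬ ⟦ A ⟧ (P⁰ n) v) ⇨ □₀ q            ≈⟨ ⇨-congʳ (◇-cong (∧-congˡ (¬-cong (P⁰≈P∘∀′ n v)))) ⟩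
    ◇ (□₀ q ∧ ¬ ⟦ A ⟧ (P n) (∀′ ∘ v)) ⇨ □₀ q      ≈⟨ P-unfold n (∀′ ∘ v) ⟨
    ⟦ A ⟧ (P (suc n)) (∀′ ∘ v)                    ∎
    where q = v (suc n)

  P-valid⇒P⁰-valid : ∀ n → A ⊨ P n → A ⊨ P⁰ n
  P-valid⇒P⁰-valid n P-valid v = trans (P⁰≈P∘∀′ n v) (P-valid (∀′ ∘ v))

  P-succ-open : ∀ n v → Open (⟦ A ⟧ (P (suc n)) v)
  P-succ-open n v = open-resp-≈ (sym (P-unfold n v)) (open-∨ open-¬◇ open-¬◇)

  □≤P-succ : ∀ n v → □ (v (suc n)) ≤ ⟦ A ⟧ (P (suc n)) v
  □≤P-succ n v = ≤-trans y≤x⇨y (≤-reflexive (sym (P-unfold n v)))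

  ¬P-succ≤◇ : ∀ n v → ¬ ⟦ A ⟧ (P (suc n)) v ≤ ◇ (□ (v (suc n)) ∧ ¬ ⟦ A ⟧ (P n) v)
  ¬P-succ≤◇ n v = ≤-trans (≤-reflexive (trans (¬-cong (P-unfold n v)) ¬⇨≈)) (x∧y≤x _ _)

  -- P⁰_n is evaluated at q_i := P_i, so that its □∀q_n is the □₀P_n produced by casari-step.
  ¬P≤◇₀¬P⁰ : A ⊨ M⁺Cas → ∀ n v → ¬ ⟦ A ⟧ (P n) v ≤ ◇₀ (¬ ⟦ A ⟧ (P⁰ n) (λ i → ⟦ A ⟧ (P i) v))
  ¬P≤◇₀¬P⁰ cas zero    v = ◇₀-T
  ¬P≤◇₀¬P⁰ cas (suc n) v = begin
    ¬ p                          ≤⟨ ¬-antitone □₀x≤x ⟩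
    ¬ u                          ≤⟨ casari-step cas (P-succ-open n v) (□≤P-succ n v) (¬P-succ≤◇ n v) ⟩
    ◇₀ (◇ (¬ p′ ∧ u) ∧ ¬ u)      ≤⟨ ◇₀-mono (∧-monotonic ◇[¬p′∧u]≤◇₀[u∧r] ≤-refl) ⟩
    ◇₀ (◇₀ (u ∧ r) ∧ ¬ u)        ≈⟨ ◇₀-cong (trans (¬-cong (P⁰-unfold n w)) ¬⇨≈) ⟨
    ◇₀ (¬ ⟦ A ⟧ (P⁰ (suc n)) w)  ∎
    where
    w = λ i → ⟦ A ⟧ (P i) v
    p = ⟦ A ⟧ (P (suc n)) v
    p′ = ⟦ A ⟧ (P n) v
    u = □₀ p
    r = ¬ ⟦ A ⟧ (P⁰ n) w

    ◇[¬p′∧u]≤◇₀[u∧r] : ◇ (¬ p′ ∧ u) ≤ ◇₀ (u ∧ r)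
    ◇[¬p′∧u]≤◇₀[u∧r] = begin
      ◇ (¬ p′ ∧ u)                 ≤⟨ ◇-mono (∧-monotonic (¬P≤◇₀¬P⁰ cas n v) □₀≤¬◇₀¬□₀) ⟩
      ◇ (◇₀ r ∧ ¬ ◇₀ (¬ u))        ≈⟨ ◇-cong (∧-comm _ _) ⟩
      ◇ (¬ ◇₀ (¬ u) ∧ ◇₀ r)        ≤⟨ ◇-mono ¬◇₀¬∧◇₀≤◇₀∧ ⟩
      ◇ (◇₀ (u ∧ r))               ≤⟨ ◇◇₀≤◇₀ ⟩
      ◇₀ (u ∧ r)                   ∎

  P⁰-valid⇒P-valid : A ⊨ M⁺Cas → ∀ n → A ⊨ P⁰ n → A ⊨ P n
  P⁰-valid⇒P-valid cas n P⁰-valid v = ¬≤⊥⇒≈⊤ (begin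
    ¬ ⟦ A ⟧ (P n) v        ≤⟨ ¬P≤◇₀¬P⁰ cas n v ⟩
    ◇₀ (¬ ⟦ A ⟧ (P⁰ n) w)  ≈⟨ ◇₀-cong (¬-cong (P⁰-valid w)) ⟩
    ◇₀ (¬ ⊤)               ≈⟨ ◇₀-cong ¬⊤≈⊥ ⟩
    ◇₀ ⊥                   ≈⟨ ◇₀-⊥ ⟩
    ⊥                      ∎)
    where w = λ i → ⟦ A ⟧ (P i) v

theorem4p13 : (V : Variety) (n : ℕ) →
    ((V ⊨V P (suc n) → V ⊨V P⁰ (suc n)) × (V ⊨V P⁰ (suc n) → V ⊨V P (suc n)))
theorem4p13 V n =
    (λ V⊨P A A∈V → P-valid⇒P⁰-valid A (suc n) (V⊨P A A∈V))
  , (λ V⊨P⁰ A A∈V → P⁰-valid⇒P-valid A (proj₁ A∈V) (suc n) (V⊨P⁰ A A∈V))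
  where open MS4Properties
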